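{- Let $k$ be a field, $k'/k$ finite and $L=k'((t))((u))$. Every $A\in End(L/k)$ is a continuous map $L\to L$ for the standard topology of $L$.
   Context: For $n\in\mathbb Z$ let $\mathcal O_n=u^nk'((t))[[u]]$. The standard topology on $L$ has as base of neighbourhoods of $0$ the subspaces $\sum_i t^{l_i}k'[[t]]u^i+\mathcal O_m$ ($l_i,m\in\mathbb Z$). For $m<n$, $\mathcal O_m/\mathcal O_n$ has the topology with base of neighbourhoods of $0$ the images of $t^lu^mk'[[t,u]]$, $l\in\mathbb Z$. $End(L/k)$ is the set of $k$-linear maps $A:L\to L$ such that: (1) for every $n$ there is $m$ with $A\mathcal O_n\subset\mathcal O_m$; (2) for every $m$ there is $n$ with $A\mathcal O_n\subset\mathcal O_m$; (3) whenever $n_1<n_2$, $m_1<m_2$ with $A\mathcal O_{n_i}\subset\mathcal O_{m_i}$, the induced map $\mathcal O_{n_1}/\mathcal O_{n_2}\to\mathcal O_{m_1}/\mathcal O_{m_2}$ is continuous. -}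

module Defs where

open import Level using (Level; _⊔_) renaming (suc to lsuc)
open import Algebra.Bundles using (CommutativeRing)
open import Algebra.Morphism.Structures using (module RingMorphisms)
open import Data.Nat using (ℕ; zero; suc)
open import Data.Fin using (Fin)
import Data.Fin as Fin
open import Data.Integer using (ℤ; _<_; _⊓_)
open import Data.Integer.Properties using (<-≤-trans; i⊓j≤i; i⊓j≤j)
open import Data.Product using (Σ; ∃; _×_; _,_; proj₁; proj₂)
open import Data.Sum using (_⊎_)
open import Relation.Nullary using (¬_)

record Field (c ℓ : Level) : Set (lsuc (c ⊔ ℓ)) where
  field
    commutativeRing : CommutativeRing c ℓ
  open CommutativeRing commutativeRing public
  field
    0≉1     : ¬ (0# ≈ 1#)
    inverse : ∀ x → ¬ (x ≈ 0#) → ∃ λ y → (x * y) ≈ 1#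

module _ {c₁ ℓ₁ c₂ ℓ₂} (k : Field c₁ ℓ₁) (k' : Field c₂ ℓ₂) where
  private
    module k  = Field k
    module k' = Field k'

  sumFin : ∀ {d} → (Fin d → k'.Carrier) → k'.Carrier
  sumFin {zero}  f = k'.0#
  sumFin {suc d} f = f Fin.zero k'.+ sumFin (λ i → f (Fin.suc i))

  record FiniteExtension : Set (c₁ ⊔ ℓ₁ ⊔ c₂ ⊔ ℓ₂) where
    field
      ι       : k.Carrier → k'.Carrier
      ι-hom   : RingMorphisms.IsRingHomomorphism k.rawRing k'.rawRing ι
      dim     : ℕ
      basis   : Fin dim → k'.Carrier
      spans   : ∀ x → ∃ λ (a : Fin dim → k.Carrier) →
                  x k'.≈ sumFin (λ i → ι (a i) k'.* basis i)

module TwoDim {c₁ ℓ₁ c₂ ℓ₂} (k : Field c₁ ℓ₁) (k' : Field c₂ ℓ₂)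
              (E : FiniteExtension k k') where
  private
    module k  = Field k
    module k' = Field k'
  open FiniteExtension E

  -- An element of L = k'((t))((u)): coeff i j is the coefficient of t^i u^j.
  -- The u-adic order is bounded below, and each u^j-coefficient is a
  -- Laurent series in t (bounded below in t).
  record L : Set (c₂ ⊔ ℓ₂) where
    field
      coeff  : ℤ → ℤ → k'.Carrier
      uBound : ∃ λ m → ∀ i j → j < m → coeff i j k'.≈ k'.0#
      tBound : ∀ j → ∃ λ l → ∀ i → i < l → coeff i j k'.≈ k'.0#
  open L public

  _≈L_ : L → L → Set ℓ₂
  x ≈L y = ∀ i j → coeff x i j k'.≈ coeff y i j

  private
    lemAdd : ∀ {a b} → a k'.≈ k'.0# → b k'.≈ k'.0# → (a k'.+ b) k'.≈ k'.0#
    lemAdd {a} {b} a≈0 b≈0 = k'.trans (k'.+-cong a≈0 b≈0) (k'.+-identityˡ k'.0#)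

    lemScal : ∀ c {b} → b k'.≈ k'.0# → (c k'.* b) k'.≈ k'.0#
    lemScal c {b} b≈0 = k'.trans (k'.*-congˡ b≈0) (k'.zeroʳ c)

  _+L_ : L → L → L
  coeff (x +L y) i j = coeff x i j k'.+ coeff y i j
  uBound (x +L y) =
    let (m₁ , p₁) = uBound x ; (m₂ , p₂) = uBound y in
    m₁ ⊓ m₂ , λ i j j< → lemAdd (p₁ i j (<-≤-trans j< (i⊓j≤i m₁ m₂)))
                                (p₂ i j (<-≤-trans j< (i⊓j≤j m₁ m₂)))
  tBound (x +L y) j =
    let (l₁ , p₁) = tBound x j ; (l₂ , p₂) = tBound y j in
    l₁ ⊓ l₂ , λ i i< → lemAdd (p₁ i (<-≤-trans i< (i⊓j≤i l₁ l₂)))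
                              (p₂ i (<-≤-trans i< (i⊓j≤j l₁ l₂)))

  _·L_ : k.Carrier → L → L
  coeff (a ·L x) i j = ι a k'.* coeff x i j
  uBound (a ·L x) = let (m , p) = uBound x in m , λ i j j< → lemScal (ι a) (p i j j<)
  tBound (a ·L x) j = let (l , p) = tBound x j in l , λ i i< → lemScal (ι a) (p i i<)

  -- 𝒪_n = u^n k'((t))[[u]]
  𝒪 : ℤ → L → Set ℓ₂
  𝒪 n x = ∀ i j → j < n → coeff x i j k'.≈ k'.0#

  -- Basic neighbourhood of 0:  Σ_j t^{l_j} k'[[t]] u^j + 𝒪_m
  -- (an element lies in it iff for each j < m its u^j-coefficient lies in
  --  t^{l_j} k'[[t]]).
  Nbhd : (ℤ → ℤ) → ℤ → L → Set ℓ₂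
  Nbhd l m x = ∀ i j → j < m → i < l j → coeff x i j k'.≈ k'.0#

  -- Preimage in 𝒪_m of the image of t^l u^m k'[[t,u]] in 𝒪_m/𝒪_n,
  -- i.e. the subspace t^l u^m k'[[t,u]] + 𝒪_n.
  QNbhd : ℤ → ℤ → ℤ → L → Set ℓ₂
  QNbhd l m n x = ∀ i j → j < n → (j < m ⊎ i < l) → coeff x i j k'.≈ k'.0#

  -- Open sets of the standard topology (translation-invariant topology
  -- with the above base of neighbourhoods of 0); subsets are predicates
  -- respecting equality of L.
  IsOpen : ∀ {ℓU} → (L → Set ℓU) → Set (c₂ ⊔ ℓ₂ ⊔ ℓU)
  IsOpen U = (∀ x y → x ≈L y → U x → U y)
           × (∀ x → U x → ∃ λ (lm : (ℤ → ℤ) × ℤ) →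
                 ∀ y → Nbhd (proj₁ lm) (proj₂ lm) y → U (x +L y))

  Continuous : ∀ ℓU → (L → L) → Set (lsuc ℓU ⊔ c₂ ⊔ ℓ₂)
  Continuous ℓU f = (U : L → Set ℓU) → IsOpen U → IsOpen (λ x → U (f x))

  Maps : (L → L) → ℤ → ℤ → Set (c₂ ⊔ ℓ₂)
  Maps A n m = ∀ x → 𝒪 n x → 𝒪 m (A x)

  record End : Set (c₁ ⊔ c₂ ⊔ ℓ₂) where
    field
      map     : L → L
      cong    : ∀ x y → x ≈L y → map x ≈L map y
      additive : ∀ x y → map (x +L y) ≈L (map x +L map y)
      homog   : ∀ a x → map (a ·L x) ≈L (a ·L map x)
      cond1   : ∀ n → ∃ λ m → Maps map n m
      cond2   : ∀ m → ∃ λ n → Maps map n m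
      -- (3): the induced map 𝒪_{n₁}/𝒪_{n₂} → 𝒪_{m₁}/𝒪_{m₂} is continuous
      -- (continuity of this additive map, expressed at 0 via the bases
      --  of neighbourhoods of 0 of the quotient topologies)
      cond3   : ∀ n₁ n₂ m₁ m₂ → n₁ < n₂ → m₁ < m₂ →
                Maps map n₁ m₁ → Maps map n₂ m₂ →
                ∀ l → ∃ λ l' → ∀ x → QNbhd l' n₁ n₂ x → QNbhd l m₁ m₂ (map x)

-- A is additive, so it suffices to show continuity at 0: every basic
-- neighbourhood V = Σ_{j<m₀} t^{l₀ j} k'[[t]] u^j + 𝒪_{m₀} contains the image
-- of a basic neighbourhood. By (2) choose n with A 𝒪_n ⊂ 𝒪_{m₀}. For each
-- row j < n, (1) gives m₁ < m₀ with A 𝒪_j ⊂ 𝒪_{m₁}, and (3) for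
-- 𝒪_j/𝒪_n → 𝒪_{m₁}/𝒪_{m₀} gives a t-order l j such that
-- t^{l j} u^j k'[[t]] + 𝒪_n is mapped into t^M u^{m₁} k'[[t,u]] + 𝒪_{m₀} ⊂ V,
-- where M bounds l₀ on [m₁, m₀). An element of Σ_{j<n} t^{l j} k'[[t]] u^j + 𝒪_n
-- has only finitely many rows below n; peeling them off one at a time shows
-- that it is mapped into V.
module Submission where

open import Defs
open import Level using () renaming (_⊔_ to _⊔ˡ_)
open import Data.Bool using (true; false; if_then_else_)
open import Data.Nat using (zero; suc)
open import Data.Integer as ℤ using (ℤ; +_; _+_; _<_; _≤_; _⊓_; _⊔_; pred; 1ℤ; 0ℤ)
open import Data.Integer.Properties
open import Data.Integer.Tactic.RingSolver using (solve-∀)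
open import Data.Product using (∃; _×_; _,_; proj₁; proj₂)
open import Data.Sum using (inj₁; inj₂)
open import Data.Empty using (⊥-elim)
open import Function using (_∘_)
open import Relation.Nullary using (yes; no; does)
open import Relation.Binary.PropositionalEquality using (_≡_; refl; sym; trans; cong; subst)

i<suc[i] : ∀ i → i < ℤ.suc i
i<suc[i] i = suc[i]≤j⇒i<j ≤-refl

i⊓pred[j]<j : ∀ i j → i ⊓ pred j < j
i⊓pred[j]<j i j = ≤-<-trans (i⊓j≤j i (pred j)) (i≤pred[j]⇒i<j ≤-refl)

module _ {p} (P : ℤ → Set p) {n : ℤ} (base : P n)
         (step : ∀ j → j < n → P (ℤ.suc j) → P j) where

  private
    fromDistance : ∀ d a → a + + d ≡ n → P a
    fromDistance zero    a eq = subst P (trans (sym eq) (+-identityʳ a)) base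
    fromDistance (suc d) a eq =
      step a (<-≤-trans (i<suc[i] a) (subst (ℤ.suc a ≤_) eq′ (i≤i+j (ℤ.suc a) (+ d))))
           (fromDistance d (ℤ.suc a) eq′)
      where
      shift : ∀ a x → a + (1ℤ + x) ≡ (1ℤ + a) + x
      shift = solve-∀
      eq′ : ℤ.suc a + + d ≡ n
      eq′ = trans (sym (shift a (+ d))) eq

  downwardInduction : ∀ {a} → a ≤ n → P a
  downwardInduction {a} a≤n = fromDistance ℤ.∣ n ℤ.- a ∣ a distance
    where
    cancel : ∀ a x → a + (x ℤ.- a) ≡ x
    cancel = solve-∀
    distance : a + + ℤ.∣ n ℤ.- a ∣ ≡ n
    distance = trans (cong (λ x → a + x) (0≤i⇒+∣i∣≡i (i≤j⇒0≤j-i a≤n))) (cancel a n)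

boundedAbove-on-interval : (f : ℤ → ℤ) (a b : ℤ) →
                           ∃ λ M → ∀ {j} → a ≤ j → j < b → f j ≤ M
boundedAbove-on-interval f a b =
  let (M , bounded) = downwardInduction BoundedFrom vacuous extend (i⊓j≤j a b)
  in M , λ a≤j → bounded (≤-trans (i⊓j≤i a b) a≤j)
  where
  BoundedFrom : ℤ → Set
  BoundedFrom a = ∃ λ M → ∀ {j} → a ≤ j → j < b → f j ≤ M

  vacuous : BoundedFrom b
  vacuous = 0ℤ , λ b≤j j<b → ⊥-elim (<-irrefl refl (≤-<-trans b≤j j<b))

  extend : ∀ a → a < b → BoundedFrom (ℤ.suc a) → BoundedFrom a
  extend a _ (M , bounded) = f a ⊔ M , bound
    where
    bound : ∀ {j} → a ≤ j → j < b → f j ≤ f a ⊔ M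
    bound {j} a≤j j<b with j ≟ a
    ... | yes refl = i≤i⊔j (f a) M
    ... | no j≢a   =
      ≤-trans (bounded (i<j⇒suc[i]≤j (≤∧≢⇒< a≤j (j≢a ∘ sym))) j<b) (i≤j⊔i (f a) M)

module _ {c₁ ℓ₁ c₂ ℓ₂} (k : Field c₁ ℓ₁) (k' : Field c₂ ℓ₂) (E : FiniteExtension k k') where
  open TwoDim k k' E
  private module k' = Field k'

  if-≈0 : ∀ b {x y} → x k'.≈ k'.0# → y k'.≈ k'.0# → (if b then x else y) k'.≈ k'.0#
  if-≈0 true  x≈0 _   = x≈0
  if-≈0 false _   y≈0 = y≈0

  Nbhd-resp : ∀ {l m} x y → x ≈L y → Nbhd l m x → Nbhd l m y
  Nbhd-resp _ _ x≈y x∈V i j j<m i<l = k'.trans (k'.sym (x≈y i j)) (x∈V i j j<m i<l)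

  Nbhd-+ : ∀ {l m} x y → Nbhd l m x → Nbhd l m y → Nbhd l m (x +L y)
  Nbhd-+ _ _ x∈V y∈V i j j<m i<l =
    k'.trans (k'.+-cong (x∈V i j j<m i<l) (y∈V i j j<m i<l)) (k'.+-identityˡ k'.0#)

  𝒪⇒Nbhd : ∀ {l m} x → 𝒪 m x → Nbhd l m x
  𝒪⇒Nbhd _ x∈𝒪 i j j<m _ = x∈𝒪 i j j<m

  QNbhd⇒Nbhd : ∀ {l M m₁ m₀} x → (∀ {j} → m₁ ≤ j → j < m₀ → l j ≤ M) →
               QNbhd M m₁ m₀ x → Nbhd l m₀ x
  QNbhd⇒Nbhd {m₁ = m₁} _ l≤M x∈Q i j j<m₀ i<lj with j <? m₁
  ... | yes j<m₁ = x∈Q i j j<m₀ (inj₁ j<m₁)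
  ... | no  j≮m₁ = x∈Q i j j<m₀ (inj₂ (<-≤-trans i<lj (l≤M (≮⇒≥ j≮m₁) j<m₀)))

  ContinuousAt0 : (L → L) → Set (c₂ ⊔ˡ ℓ₂)
  ContinuousAt0 f = ∀ l₀ m₀ → ∃ λ (lm : (ℤ → ℤ) × ℤ) →
                      ∀ y → Nbhd (proj₁ lm) (proj₂ lm) y → Nbhd l₀ m₀ (f y)

  additive⇒continuous : ∀ ℓU {f : L → L} → (∀ x y → x ≈L y → f x ≈L f y) →
                        (∀ x y → f (x +L y) ≈L (f x +L f y)) →
                        ContinuousAt0 f → Continuous ℓU f
  additive⇒continuous ℓU {f} f-cong f-+ f-cont₀ U (U-resp , U-open) =
    (λ x y x≈y → U-resp (f x) (f y) (f-cong x y x≈y)) , preimage-open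
    where
    preimage-open : ∀ x → U (f x) → ∃ λ (lm : (ℤ → ℤ) × ℤ) →
                      ∀ y → Nbhd (proj₁ lm) (proj₂ lm) y → U (f (x +L y))
    preimage-open x fx∈U =
      let ((l₀ , m₀) , fx+V⊆U) = U-open (f x) fx∈U
          (lm , f[W]⊆V)        = f-cont₀ l₀ m₀
      in lm , λ y y∈W →
        U-resp _ _ (λ i j → k'.sym (f-+ x y i j)) (fx+V⊆U (f y) (f[W]⊆V y y∈W))

  row : ℤ → L → L
  coeff (row j₀ y) i j = if does (j ≟ j₀) then coeff y i j else k'.0#
  uBound (row j₀ y) = j₀ , below
    where
    below : ∀ i j → j < j₀ → (if does (j ≟ j₀) then coeff y i j else k'.0#) k'.≈ k'.0#
    below i j j<j₀ with j ≟ j₀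
    ... | yes refl = ⊥-elim (<-irrefl refl j<j₀)
    ... | no _     = k'.refl
  tBound (row j₀ y) j =
    let (l , below) = tBound y j in l , λ i i<l → if-≈0 (does (j ≟ j₀)) (below i i<l) k'.refl

  withoutRow : ℤ → L → L
  coeff (withoutRow j₀ y) i j = if does (j ≟ j₀) then k'.0# else coeff y i j
  uBound (withoutRow j₀ y) =
    let (m , below) = uBound y in m , λ i j j<m → if-≈0 (does (j ≟ j₀)) k'.refl (below i j j<m)
  tBound (withoutRow j₀ y) j =
    let (l , below) = tBound y j in l , λ i i<l → if-≈0 (does (j ≟ j₀)) k'.refl (below i i<l)

  ≈-row+withoutRow : ∀ j₀ y → y ≈L (row j₀ y +L withoutRow j₀ y)
  ≈-row+withoutRow j₀ y i j with j ≟ j₀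
  ... | yes _ = k'.sym (k'.+-identityʳ _)
  ... | no _  = k'.sym (k'.+-identityˡ _)

  row-QNbhd : ∀ {l j₀ n} y → (∀ i → i < l → coeff y i j₀ k'.≈ k'.0#) →
              QNbhd l j₀ n (row j₀ y)
  row-QNbhd {j₀ = j₀} y row-order i j _ below with j ≟ j₀
  row-QNbhd y row-order i j _ (inj₁ j<j) | yes refl = ⊥-elim (<-irrefl refl j<j)
  row-QNbhd y row-order i j _ (inj₂ i<l) | yes refl = row-order i i<l
  ... | no _ = k'.refl

  withoutRow-𝒪 : ∀ {j₀} y → 𝒪 j₀ y → 𝒪 (ℤ.suc j₀) (withoutRow j₀ y)
  withoutRow-𝒪 {j₀} y y∈𝒪 i j j<suc with j ≟ j₀
  ... | yes _   = k'.refl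
  ... | no j≢j₀ =
    y∈𝒪 i j (≤∧≢⇒< (subst (j ≤_) (pred-suc j₀) (i<j⇒i≤pred[j] j<suc)) j≢j₀)

  withoutRow-Nbhd : ∀ {l m j₀} y → Nbhd l m y → Nbhd l m (withoutRow j₀ y)
  withoutRow-Nbhd {j₀ = j₀} y y∈V i j j<m i<l with j ≟ j₀
  ... | yes _ = k'.refl
  ... | no _  = y∈V i j j<m i<l

  module _ (A : End) where
    open End A renaming (cong to map-cong)

    map-row+withoutRow : ∀ j y → (map (row j y) +L map (withoutRow j y)) ≈L map y
    map-row+withoutRow j y i j′ =
      k'.sym (k'.trans (map-cong _ _ (≈-row+withoutRow j y) i j′) (additive _ _ i j′))

    module Preimage (l₀ : ℤ → ℤ) (m₀ : ℤ) where

      n : ℤ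
      n = proj₁ (cond2 m₀)

      m₁ : ℤ → ℤ
      m₁ j = proj₁ (cond1 j) ⊓ pred m₀

      maps-m₁ : ∀ j → Maps map j (m₁ j)
      maps-m₁ j x x∈𝒪 i j′ j′<m₁ =
        proj₂ (cond1 j) x x∈𝒪 i j′ (<-≤-trans j′<m₁ (i⊓j≤i _ _))

      rowBound : ∀ j → ∃ λ M → ∀ {j′} → m₁ j ≤ j′ → j′ < m₀ → l₀ j′ ≤ M
      rowBound j = boundedAbove-on-interval l₀ (m₁ j) m₀

      rowCondition : ∀ j → j < n → ∃ λ l → ∀ x → QNbhd l j n x →
                     QNbhd (proj₁ (rowBound j)) (m₁ j) m₀ (map x)
      rowCondition j j<n = cond3 j n (m₁ j) m₀ j<n (i⊓pred[j]<j _ m₀)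
                                 (maps-m₁ j) (proj₂ (cond2 m₀)) (proj₁ (rowBound j))

      -- The value outside j < n is irrelevant: rows ≥ n lie in 𝒪_n.
      tOrder : ℤ → ℤ
      tOrder j with j <? n
      ... | yes j<n = proj₁ (rowCondition j j<n)
      ... | no _    = 0ℤ

      row-mapped : ∀ j → j < n → ∀ x → QNbhd (tOrder j) j n x → Nbhd l₀ m₀ (map x)
      row-mapped j j<n x x∈Q with j <? n
      ... | yes j<n′ =
        QNbhd⇒Nbhd (map x) (proj₂ (rowBound j)) (proj₂ (rowCondition j j<n′) x x∈Q)
      ... | no j≮n   = ⊥-elim (j≮n j<n)

      MappedFrom : ℤ → Set (c₂ ⊔ˡ ℓ₂)
      MappedFrom a = ∀ y → 𝒪 a y → Nbhd tOrder n y → Nbhd l₀ m₀ (map y)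

      mapped-from-n : MappedFrom n
      mapped-from-n y y∈𝒪 _ = 𝒪⇒Nbhd (map y) (proj₂ (cond2 m₀) y y∈𝒪)

      peel-row : ∀ j → j < n → MappedFrom (ℤ.suc j) → MappedFrom j
      peel-row j j<n mapped y y∈𝒪 y∈W =
        Nbhd-resp (map (row j y) +L map (withoutRow j y)) (map y) (map-row+withoutRow j y)
          (Nbhd-+ (map (row j y)) (map (withoutRow j y))
            (row-mapped j j<n (row j y) (row-QNbhd y λ i i<l → y∈W i j j<n i<l))
            (mapped (withoutRow j y) (withoutRow-𝒪 y y∈𝒪)
                    (withoutRow-Nbhd y y∈W)))

      preimage : ∀ y → Nbhd tOrder n y → Nbhd l₀ m₀ (map y)
      preimage y =
        let (m , y∈𝒪) = uBound y in
        downwardInduction MappedFrom mapped-from-n peel-row (i⊓j≤j m n)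
          y (λ i j j<m⊓n → y∈𝒪 i j (<-≤-trans j<m⊓n (i⊓j≤i m n)))

    End-continuousAt0 : ContinuousAt0 map
    End-continuousAt0 l₀ m₀ = (tOrder , n) , preimage
      where open Preimage l₀ m₀

lemma2 : ∀ {c₁ ℓ₁ c₂ ℓ₂} ℓU (k : Field c₁ ℓ₁) (k' : Field c₂ ℓ₂) (E : FiniteExtension k k')
    (A : TwoDim.End k k' E) → TwoDim.Continuous k k' E ℓU (TwoDim.End.map A)
lemma2 ℓU k k' E A =
  additive⇒continuous k k' E ℓU (TwoDim.End.cong A) (TwoDim.End.additive A)
                      (End-continuousAt0 k k' E A)
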